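{- Let $I=(G,S,T,k)$ be an instance of \textsc{Disjoint Subset-DFVS Compression} and $Z\subseteq V(G)\setminus T$. Let $I/Z=(G',S',T,k)$ where $(G',S')=\mathrm{torso}(G,V(G)\setminus Z,S)$. Then: (1) if $I$ is a no-instance, then $I/Z$ is also a no-instance; (2) if $I$ has a solution $T'$ with $f_{G,T}(T')\cup r_{G,T}(T')\subseteq Z$ and $T'\cap Z=\emptyset$, then $T'$ is a shadowless solution of $I/Z$, i.e., a solution of $I/Z$ with $f_{G',T}(T')=r_{G',T}(T')=\emptyset$.
   Context: \textsc{Disjoint Subset-DFVS Compression}: an instance $(G,S,T,k)$ consists of a directed graph $G$, $S\subseteq E(G)$, a positive integer $k$, and $T\subseteq V(G)$ such that $G\setminus T$ has no $S$-closed-walk (closed walk containing an edge of $S$); a solution is a set $T'\subseteq V(G)$ with $|T'|\le k$, $T'\cap T=\emptyset$ and $G\setminus T'$ having no $S$-closed-walk; it is a yes-instance iff a solution exists. $\mathrm{torso}(G,C,S)$ is the pair $(G',S')$ where $G'$ has vertex set $C$ and edge $(a,b)$ iff there is an $a\to b$ walk in $G$ whose internal vertices are not in $C$; $S'$ consists of the edges of $S$ with both endpoints in $C$ together with every $(a,b)$ for which some $a\to b$ walk in $G$ with internal vertices outside $C$ contains an edge of $S$. For a digraph $H$ and $X\subseteq V(H)$: $f_{H,T}(X)$ is the set of vertices $v$ such that $X\subseteq V(H)\setminus(T\cup\{v\})$ and $H\setminus X$ has no path from $T$ to $v$; $r_{H,T}(X)$ is the set of $v$ such that $X\subseteq V(H)\setminus(T\cup\{v\})$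 and $H\setminus X$ has no path from $v$ to $T$. -}

module Defs where

open import Data.Nat using (ℕ; _≤_)
open import Data.Fin using (Fin)
open import Data.Fin.Subset using (Subset; _∈_; _∉_; _⊆_; _─_; ∣_∣)
open import Data.Bool using (Bool)
open import Data.List using (List; []; _∷_)
open import Data.List.Relation.Unary.All using (All)
open import Data.List.Relation.Unary.Any using (Any)
open import Data.Product using (Σ; ∃; _×_; _,_)
open import Data.Sum using (_⊎_)
open import Relation.Nullary using (¬_)
open import Relation.Binary.PropositionalEquality using (_≡_)

Rel : ℕ → Set₁
Rel n = Fin n → Fin n → Set

-- A finite digraph: its vertex set is a subset V of the universe Fin n,
-- and its edges are the pairs (a , b) with a, b ∈ V and E a b.
-- (Using a subset of a fixed universe lets vertex deletion and torsos
-- keep the same vertex names.)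
record Digraph (n : ℕ) : Set₁ where
  constructor digraph
  field
    V : Subset n
    E : Rel n
open Digraph public

Edge : ∀ {n} → Digraph n → Rel n
Edge G a b = a ∈ V G × b ∈ V G × E G a b

_∖_ : ∀ {n} → Digraph n → Subset n → Digraph n
G ∖ X = digraph (V G ─ X) (E G)

data Walk {n} (R : Rel n) : Fin n → Fin n → Set where
  edge : ∀ {a b} → R a b → Walk R a b
  _◅_  : ∀ {a b c} → R a b → Walk R b c → Walk R a c

internal : ∀ {n} {R : Rel n} {a b} → Walk R a b → List (Fin n)
internal (edge _) = []
internal (_◅_ {b = b} _ w) = b ∷ internal w

edges : ∀ {n} {R : Rel n} {a b} → Walk R a b → List (Fin n × Fin n)
edges (edge {a} {b} _) = (a , b) ∷ []
edges (_◅_ {a} {b} _ w) = (a , b) ∷ edges w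

ContainsS : ∀ {n} {R : Rel n} (S : Rel n) {a b} → Walk R a b → Set
ContainsS S w = Any (λ e → S (Data.Product.proj₁ e) (Data.Product.proj₂ e)) (edges w)

HasSClosedWalk : ∀ {n} → Digraph n → Rel n → Set
HasSClosedWalk G S = Σ _ λ a → Σ (Walk (Edge G) a a) λ w → ContainsS S w

Reach : ∀ {n} → Digraph n → Fin n → Fin n → Set
Reach G a b = (a ∈ V G × a ≡ b) ⊎ Walk (Edge G) a b

Disjoint : ∀ {n} → Subset n → Subset n → Set
Disjoint A B = ∀ x → x ∈ A → x ∉ B

IsInstance : ∀ {n} → Digraph n → Rel n → Subset n → ℕ → Set
IsInstance G S T k =
  (∀ a b → S a b → Edge G a b) × T ⊆ V G × 1 ≤ k × ¬ HasSClosedWalk (G ∖ T) S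

IsSolution : ∀ {n} → Digraph n → Rel n → Subset n → ℕ → Subset n → Set
IsSolution G S T k T' =
  T' ⊆ V G × ∣ T' ∣ ≤ k × Disjoint T' T × ¬ HasSClosedWalk (G ∖ T') S

HasSolution : ∀ {n} → Digraph n → Rel n → Subset n → ℕ → Set
HasSolution G S T k = Σ (Subset _) λ T' → IsSolution G S T k T'

Avoids : ∀ {n} → Digraph n → Subset n → Subset n → Fin n → Set
Avoids H T X v = X ⊆ V H × Disjoint X T × v ∉ X

InF : ∀ {n} → Digraph n → Subset n → Subset n → Fin n → Set
InF H T X v = v ∈ V H × Avoids H T X v × (∀ t → t ∈ T → ¬ Reach (H ∖ X) t v)

InR : ∀ {n} → Digraph n → Subset n → Subset n → Fin n → Set
InR H T X v = v ∈ V H × Avoids H T X v × (∀ t → t ∈ T → ¬ Reach (H ∖ X) v t)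

TorsoEdge : ∀ {n} → Digraph n → Subset n → Rel n
TorsoEdge G C a b = a ∈ C × b ∈ C ×
  Σ (Walk (Edge G) a b) λ w → All (λ x → x ∉ C) (internal w)

torsoGraph : ∀ {n} → Digraph n → Subset n → Digraph n
torsoGraph G C = digraph C (TorsoEdge G C)

torsoS : ∀ {n} → Digraph n → Subset n → Rel n → Rel n
torsoS G C S a b =
  (a ∈ C × b ∈ C × S a b) ⊎
  (a ∈ C × b ∈ C × Σ (Walk (Edge G) a b) λ w → All (λ x → x ∉ C) (internal w) × ContainsS S w)

module Submission where

-- Write C = V(G) ∖ Z for the kept vertices and (G', S') for the torso.
-- A torso edge a → b is a G-walk a ⇝ b whose internal vertices lie in Z,
-- so the whole proof is about moving walks between G and G' in both
-- directions while tracking whether they contain an S-edge ("are marked").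
--
-- A walk of G ∖ X between two C-vertices is cut at its
--    C-vertices; the pieces are torso edges, and a piece containing an
--    S-edge is an S'-edge.  A closed walk of G ∖ X either meets C (rotate
--    it to start there and project) or lies inside Z, hence avoids T.
--  * Expansion.  If X ∩ Z = ∅, every torso edge of G' ∖ X unfolds back
--    into a walk of G ∖ X, and an S'-edge into a marked such walk.
--
-- Part (1) of the theorem is projection of closed walks (contrapositive);
-- part (2) is expansion of closed walks, plus projection of paths, which
-- shows that a shadow of T' in the torso would be a shadow in G, i.e. in Z.

open import Defs
open import Data.Nat using (ℕ)
open import Data.Fin using (Fin)
open import Data.Fin.Subset using (Subset; _∈_; _∉_; _⊆_; _─_; inside; outside)
open import Data.Fin.Subset.Properties using (_∈?_; x∈p∧x∉q⇒x∈p─q; p─q⊆p)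
open import Data.Product using (Σ; ∃-syntax; _×_; _,_; proj₁; proj₂)
open import Data.Sum as Sum using (_⊎_; inj₁; inj₂; [_,_]′)
open import Data.Empty using (⊥; ⊥-elim)
open import Data.List using (_∷_; _++_)
open import Data.List.Relation.Unary.All as All using (All; []; _∷_)
open import Data.List.Relation.Unary.Any using (Any; here; there; any?)
import Data.List.Relation.Unary.Any.Properties as Anyᵖ
import Data.List.Relation.Unary.All.Properties as Allᵖ
open import Data.Vec using (_∷_)
open import Data.Vec.Base using (here; there)
open import Function using (_∘_)
open import Relation.Nullary using (¬_; yes; no; contradiction)
open import Relation.Unary using (Decidable)
open import Relation.Binary.PropositionalEquality using (_≡_; refl; sym; cong; subst)

x∈p─q⇒x∉q : ∀ {n} (p q : Subset n) {x : Fin n} → x ∈ p ─ q → x ∉ q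
x∈p─q⇒x∉q (inside ∷ p) (outside ∷ q) here ()
x∈p─q⇒x∉q (_ ∷ p) (_ ∷ q) (there x∈p─q) (there x∈q) = x∈p─q⇒x∉q p q x∈p─q x∈q

module _ {n : ℕ} {R : Rel n} where

  infixr 5 _++ʷ_

  _++ʷ_ : ∀ {a b c} → Walk R a b → Walk R b c → Walk R a c
  edge e  ++ʷ w = e ◅ w
  (e ◅ v) ++ʷ w = e ◅ (v ++ʷ w)

  edges-++ : ∀ {a b c} (v : Walk R a b) (w : Walk R b c) →
             edges (v ++ʷ w) ≡ edges v ++ edges w
  edges-++ (edge e) w = refl
  edges-++ (e ◅ v)  w = cong (_ ∷_) (edges-++ v w)

  marked-++⁺ : ∀ (Q : Rel n) {a b c} (v : Walk R a b) (w : Walk R b c) →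
               ContainsS Q v ⊎ ContainsS Q w → ContainsS Q (v ++ʷ w)
  marked-++⁺ Q v w m =
    subst (Any (λ e → Q (proj₁ e) (proj₂ e))) (sym (edges-++ v w))
          ([ Anyᵖ.++⁺ˡ , Anyᵖ.++⁺ʳ (edges v) ]′ m)

  marked-++⁻ : ∀ (Q : Rel n) {a b c} (v : Walk R a b) (w : Walk R b c) →
               ContainsS Q (v ++ʷ w) → ContainsS Q v ⊎ ContainsS Q w
  marked-++⁻ Q v w m =
    Anyᵖ.++⁻ (edges v) (subst (Any (λ e → Q (proj₁ e) (proj₂ e))) (edges-++ v w) m)

  mapʷ : ∀ {R' : Rel n} → (∀ {a b} → R a b → R' a b) → ∀ {a b} → Walk R a b → Walk R' a b
  mapʷ f (edge e) = edge (f e)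
  mapʷ f (e ◅ w)  = f e ◅ mapʷ f w

  internal-map : ∀ {R' : Rel n} (f : ∀ {a b} → R a b → R' a b) {a b} (w : Walk R a b) →
                 internal (mapʷ f w) ≡ internal w
  internal-map f (edge e) = refl
  internal-map f (e ◅ w)  = cong (_ ∷_) (internal-map f w)

  marked-map : ∀ {R' Q Q' : Rel n} (f : ∀ {a b} → R a b → R' a b) (g : ∀ {a b} → Q a b → Q' a b)
               {a b} (w : Walk R a b) → ContainsS Q w → ContainsS Q' (mapʷ f w)
  marked-map f g (edge e) (here q)  = here (g q)
  marked-map f g (e ◅ w)  (here q)  = here (g q)
  marked-map f g (e ◅ w)  (there m) = there (marked-map f g w m)

  module _ {R' : Rel n} (Good : Fin n → Set)
           (transfer : ∀ {a b} → Good a → Good b → R a b → R' a b) where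

    restrict : ∀ {a b} (w : Walk R a b) → Good a → Good b → All Good (internal w) → Walk R' a b
    restrict (edge e) ga gb []        = edge (transfer ga gb e)
    restrict (e ◅ w)  ga gb (gy ∷ gs) = transfer ga gy e ◅ restrict w gy gb gs

    marked-restrict : ∀ (Q : Rel n) {a b} (w : Walk R a b) (ga : Good a) (gb : Good b)
                      (gs : All Good (internal w)) → ContainsS Q w → ContainsS Q (restrict w ga gb gs)
    marked-restrict Q (edge e) ga gb []        m         = m
    marked-restrict Q (e ◅ w)  ga gb (gy ∷ gs) (here q)  = here q
    marked-restrict Q (e ◅ w)  ga gb (gy ∷ gs) (there m) = there (marked-restrict Q w gy gb gs m)

  cut : ∀ {P : Fin n → Set} {a b} (w : Walk R a b) → Any P (internal w) →
        ∃[ c ] P c × Σ (Walk R a c) λ u → Σ (Walk R c b) λ v → u ++ʷ v ≡ w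
  cut (e ◅ w) (here pc) = _ , pc , edge e , w , refl
  cut (e ◅ w) (there p) with cut w p
  ... | c , pc , u , v , u++v≡w = c , pc , e ◅ u , v , cong (e ◅_) u++v≡w

  rotate : ∀ {P : Fin n → Set} (Q : Rel n) {a} (w : Walk R a a) → Any P (internal w) →
           ∃[ c ] P c × Σ (Walk R c c) λ w' → ContainsS Q w → ContainsS Q w'
  rotate Q w p with cut w p
  ... | c , pc , u , v , refl =
    c , pc , v ++ʷ u , marked-++⁺ Q v u ∘ Sum.swap ∘ marked-++⁻ Q u v

  module _ {R' : Rel n} (expand : ∀ {a b} → R' a b → Walk R a b) where

    flatten : ∀ {a b} → Walk R' a b → Walk R a b
    flatten (edge e) = expand e
    flatten (e ◅ w)  = expand e ++ʷ flatten w

    flatten-marked : ∀ {Q Q' : Rel n}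
      (expand-marked : ∀ {a b} → R' a b → Q' a b → Σ (Walk R a b) (ContainsS Q))
      {a b} (w : Walk R' a b) → ContainsS Q' w → Σ (Walk R a b) (ContainsS Q)
    flatten-marked expand-marked (edge e) (here q) = expand-marked e q
    flatten-marked expand-marked (e ◅ w)  (here q) with expand-marked e q
    ... | u , m = u ++ʷ flatten w , marked-++⁺ _ u (flatten w) (inj₁ m)
    flatten-marked expand-marked (e ◅ w) (there m) with flatten-marked expand-marked w m
    ... | u , m' = expand e ++ʷ u , marked-++⁺ _ (expand e) u (inj₂ m')

module _ {n : ℕ} {H : Digraph n} where

  start∈V : ∀ {a b} → Walk (Edge H) a b → a ∈ V H
  start∈V (edge (a∈ , _)) = a∈
  start∈V ((a∈ , _) ◅ w)  = a∈

  end∈V : ∀ {a b} → Walk (Edge H) a b → b ∈ V H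
  end∈V (edge (_ , b∈ , _)) = b∈
  end∈V (e ◅ w)             = end∈V w

  internal∈V : ∀ {a b} (w : Walk (Edge H) a b) → All (_∈ V H) (internal w)
  internal∈V (edge e) = []
  internal∈V (e ◅ w)  = start∈V w ∷ internal∈V w

-- For R = Edge G and P = (_∈ C),
-- Link is literally TorsoEdge G C, and MarkedLink is the second half of
-- torsoS G C Q.
module Torso {n : ℕ} (R : Rel n) (P : Fin n → Set) (Q : Rel n) where

  Link : Rel n
  Link a b = P a × P b × Σ (Walk R a b) λ s → All (λ x → ¬ P x) (internal s)

  MarkedLink : Rel n
  MarkedLink a b =
    P a × P b × Σ (Walk R a b) λ s → All (λ x → ¬ P x) (internal s) × ContainsS Q s

  Links⁰ : Rel n
  Links⁰ a b = a ≡ b ⊎ Walk Link a b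

  Marked⁰ : ∀ {a b} → Links⁰ a b → Set
  Marked⁰ (inj₁ _) = ⊥
  Marked⁰ (inj₂ t) = ContainsS MarkedLink t

  _◅⁰_ : ∀ {a b c} → Link a b → Links⁰ b c → Walk Link a c
  l ◅⁰ inj₁ refl = edge l
  l ◅⁰ inj₂ t    = l ◅ t

  marked-◅⁰ : ∀ {a b c} (l : Link a b) (t : Links⁰ b c) →
              MarkedLink a b ⊎ Marked⁰ t → ContainsS MarkedLink (l ◅⁰ t)
  marked-◅⁰ l (inj₁ refl) (inj₁ m) = here m
  marked-◅⁰ l (inj₂ t)    (inj₁ m) = here m
  marked-◅⁰ l (inj₂ t)    (inj₂ m) = there m

  record Decomposition {a b} (w : Walk R a b) : Set where
    field
      {first}        : Fin n
      first∈P        : P first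
      segment        : Walk R a first
      segment-avoids : All (λ x → ¬ P x) (internal segment)
      rest           : Links⁰ first b
      marks          : ContainsS Q w → ContainsS Q segment ⊎ Marked⁰ rest

  decompose : Decidable P → ∀ {a b} (w : Walk R a b) → P b → Decomposition w
  decompose P? (edge e) pb = record
    { first∈P = pb ; segment = edge e ; segment-avoids = [] ; rest = inj₁ refl ; marks = inj₁ }
  decompose P? (_◅_ {b = y} e w) pb with P? y | decompose P? w pb
  ... | yes py | d = record
    { first∈P = py ; segment = edge e ; segment-avoids = [] ; rest = inj₂ (link ◅⁰ rest)
    ; marks = λ { (here q) → inj₁ (here q)
                ; (there m) → inj₂ (marked-◅⁰ link rest
                                     (Sum.map₁ (λ m' → py , first∈P , segment , segment-avoids , m')
                                               (marks m))) } }
    where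
      open Decomposition d
      link : Link y first
      link = py , first∈P , segment , segment-avoids
  ... | no ¬py | d = record
    { first∈P = first∈P ; segment = e ◅ segment ; segment-avoids = ¬py ∷ segment-avoids
    ; rest = rest
    ; marks = λ { (here q) → inj₁ (here q) ; (there m) → Sum.map₁ there (marks m) } }
    where open Decomposition d

  factor : Decidable P → ∀ {a b} (w : Walk R a b) → P a → P b →
           Σ (Walk Link a b) λ t → ContainsS Q w → ContainsS MarkedLink t
  factor P? w pa pb =
    link ◅⁰ rest ,
    marked-◅⁰ link rest ∘ Sum.map₁ (λ m → pa , first∈P , segment , segment-avoids , m) ∘ marks
    where
      open Decomposition (decompose P? w pb)
      link : Link _ first
      link = pa , first∈P , segment , segment-avoids

module Compression {n : ℕ} (G : Digraph n) (S : Rel n) (Z : Subset n) where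

  C : Subset n
  C = V G ─ Z

  G' : Digraph n
  G' = torsoGraph G C

  S' : Rel n
  S' = torsoS G C S

  ∉C⇒∈Z : ∀ {v} → v ∈ V G → v ∉ C → v ∈ Z
  ∉C⇒∈Z {v} v∈G v∉C with v ∈? Z
  ... | yes v∈Z = v∈Z
  ... | no  v∉Z = contradiction (x∈p∧x∉q⇒x∈p─q v∈G v∉Z) v∉C

  deleted⇒∉ : ∀ (H : Digraph n) (X : Subset n) {v} → v ∈ V (H ∖ X) → v ∉ X
  deleted⇒∉ H X = x∈p─q⇒x∉q (V H) X

  module Projection (X : Subset n) where
    open Torso (Edge (G ∖ X)) (_∈ C) S

    forget : ∀ {a b} → Edge (G ∖ X) a b → Edge G a b
    forget (a∈ , b∈ , e) = p─q⊆p (V G) X a∈ , p─q⊆p (V G) X b∈ , e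

    forget-segment : ∀ {a b} (s : Walk (Edge (G ∖ X)) a b) →
                     All (_∉ C) (internal s) → All (_∉ C) (internal (mapʷ forget s))
    forget-segment s = subst (All (_∉ C)) (sym (internal-map forget s))

    link⇒edge : ∀ {a b} → Link a b → Edge (G' ∖ X) a b
    link⇒edge (a∈C , b∈C , s , avoids) =
      x∈p∧x∉q⇒x∈p─q a∈C (deleted⇒∉ G X (start∈V s)) ,
      x∈p∧x∉q⇒x∈p─q b∈C (deleted⇒∉ G X (end∈V s)) ,
      a∈C , b∈C , mapʷ forget s , forget-segment s avoids

    markedLink⇒S' : ∀ {a b} → MarkedLink a b → S' a b
    markedLink⇒S' (a∈C , b∈C , s , avoids , m) =
      inj₂ (a∈C , b∈C , mapʷ forget s , forget-segment s avoids , marked-map forget (λ q → q) s m)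

    project : ∀ {a b} (w : Walk (Edge (G ∖ X)) a b) → a ∈ C → b ∈ C →
              Σ (Walk (Edge (G' ∖ X)) a b) λ t → ContainsS S w → ContainsS S' t
    project w a∈C b∈C with factor (_∈? C) w a∈C b∈C
    ... | t , marks = mapʷ link⇒edge t , marked-map link⇒edge markedLink⇒S' t ∘ marks

    project-reach : ∀ {a b} → a ∈ C → b ∈ C → Reach (G ∖ X) a b → Reach (G' ∖ X) a b
    project-reach a∈C b∈C (inj₁ (a∈ , refl)) = inj₁ (x∈p∧x∉q⇒x∈p─q a∈C (deleted⇒∉ G X a∈) , refl)
    project-reach a∈C b∈C (inj₂ w)           = inj₂ (proj₁ (project w a∈C b∈C))

    closed-at : ∀ {c} → c ∈ C → (w : Walk (Edge (G ∖ X)) c c) → ContainsS S w →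
                HasSClosedWalk (G' ∖ X) S'
    closed-at c∈C w m with project w c∈C c∈C
    ... | t , marks = _ , t , marks m

    -- An S-closed walk of G ∖ X through a kept vertex gives an S'-closed
    -- walk of G' ∖ X (rotate it to start at that vertex); one avoiding C
    -- lies in Z and so survives deleting any T disjoint from Z.
    project-closed : (T : Subset n) → Disjoint Z T → ¬ HasSClosedWalk (G ∖ T) S →
                     HasSClosedWalk (G ∖ X) S → HasSClosedWalk (G' ∖ X) S'
    project-closed T Z∩T=∅ T-acyclic (a , w , m) with a ∈? C | any? (_∈? C) (internal w)
    ... | yes a∈C | _ = closed-at a∈C w m
    ... | no a∉C | yes through-C =
      let c , c∈C , w' , marks = rotate S w through-C in closed-at c∈C w' (marks m)
    ... | no a∉C | no avoids-C =
      ⊥-elim (T-acyclic (a , restrict (_∉ C) keep w a∉C a∉C avoids ,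
                         marked-restrict (_∉ C) keep S w a∉C a∉C avoids m))
      where
        avoids : All (_∉ C) (internal w)
        avoids = Allᵖ.¬Any⇒All¬ (internal w) avoids-C

        survives : ∀ {v} → v ∈ V (G ∖ X) → v ∉ C → v ∈ V (G ∖ T)
        survives v∈ v∉C =
          x∈p∧x∉q⇒x∈p─q (p─q⊆p (V G) X v∈) (Z∩T=∅ _ (∉C⇒∈Z (p─q⊆p (V G) X v∈) v∉C))

        keep : ∀ {a b} → a ∉ C → b ∉ C → Edge (G ∖ X) a b → Edge (G ∖ T) a b
        keep a∉C b∉C (a∈ , b∈ , e) = survives a∈ a∉C , survives b∈ b∉C , e

  -- Expansion: if X ∩ Z = ∅, torso edges of G' ∖ X unfold into walks of
  -- G ∖ X, since their internal vertices lie in Z; an S'-edge unfolds into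
  -- a walk containing an S-edge (here S ⊆ E(G) is needed).
  module Expansion (S⊆E : ∀ a b → S a b → Edge G a b) (X : Subset n) (X∩Z=∅ : Disjoint X Z) where

    keep : ∀ {a b} → a ∉ X → b ∉ X → Edge G a b → Edge (G ∖ X) a b
    keep a∉X b∉X (a∈ , b∈ , e) = x∈p∧x∉q⇒x∈p─q a∈ a∉X , x∈p∧x∉q⇒x∈p─q b∈ b∉X , e

    segment-avoids-X : ∀ {a b} (s : Walk (Edge G) a b) → All (_∉ C) (internal s) →
                       All (_∉ X) (internal s)
    segment-avoids-X s avoids =
      All.zipWith (λ { (v∈G , v∉C) v∈X → X∩Z=∅ _ v∈X (∉C⇒∈Z v∈G v∉C) }) (internal∈V s , avoids)

    lift : ∀ {a b} → a ∉ X → b ∉ X → (s : Walk (Edge G) a b) → All (_∉ C) (internal s) →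
           Walk (Edge (G ∖ X)) a b
    lift a∉X b∉X s avoids = restrict (_∉ X) keep s a∉X b∉X (segment-avoids-X s avoids)

    expand : ∀ {a b} → Edge (G' ∖ X) a b → Walk (Edge (G ∖ X)) a b
    expand (a∈ , b∈ , _ , _ , s , avoids) =
      lift (deleted⇒∉ G' X a∈) (deleted⇒∉ G' X b∈) s avoids

    expand-marked : ∀ {a b} → Edge (G' ∖ X) a b → S' a b → Σ (Walk (Edge (G ∖ X)) a b) (ContainsS S)
    expand-marked {a} {b} (a∈ , b∈ , _) (inj₁ (_ , _ , sab)) =
      edge (keep (deleted⇒∉ G' X a∈) (deleted⇒∉ G' X b∈) (S⊆E a b sab)) , here sab
    expand-marked (a∈ , b∈ , _) (inj₂ (_ , _ , s , avoids , m)) =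
      lift a∉X b∉X s avoids ,
      marked-restrict (_∉ X) keep S s a∉X b∉X (segment-avoids-X s avoids) m
      where
        a∉X = deleted⇒∉ G' X a∈
        b∉X = deleted⇒∉ G' X b∈

    expand-closed : HasSClosedWalk (G' ∖ X) S' → HasSClosedWalk (G ∖ X) S
    expand-closed (a , t , m) = a , flatten-marked expand expand-marked t m

  -- Since paths between kept vertices project, a vertex of the torso that
  -- X separates from (or to) T ⊆ C in G' is separated from (to) T in G.
  module Shadows (T X : Subset n) (T⊆C : T ⊆ C) (X⊆V : X ⊆ V G) where
    open Projection X

    torso-f⇒f : ∀ {v} → InF G' T X v → InF G T X v
    torso-f⇒f (v∈C , (_ , X∩T=∅ , v∉X) , unreachable) =
      p─q⊆p (V G) Z v∈C , (X⊆V , X∩T=∅ , v∉X) ,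
      λ t t∈T path → unreachable t t∈T (project-reach (T⊆C t∈T) v∈C path)

    torso-r⇒r : ∀ {v} → InR G' T X v → InR G T X v
    torso-r⇒r (v∈C , (_ , X∩T=∅ , v∉X) , unreachable) =
      p─q⊆p (V G) Z v∈C , (X⊆V , X∩T=∅ , v∉X) ,
      λ t t∈T path → unreachable t t∈T (project-reach v∈C (T⊆C t∈T) path)

lemma13 : ∀ {n} (G : Digraph n) (S : Rel n) (T : Subset n) (k : ℕ) (Z : Subset n) →
    IsInstance G S T k → Z ⊆ V G → Disjoint Z T →
    (¬ HasSolution G S T k →
       ¬ HasSolution (torsoGraph G (V G ─ Z)) (torsoS G (V G ─ Z) S) T k)
    × (∀ T' → IsSolution G S T k T' →
         (∀ v → InF G T T' v ⊎ InR G T T' v → v ∈ Z) → Disjoint T' Z →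
         IsSolution (torsoGraph G (V G ─ Z)) (torsoS G (V G ─ Z) S) T k T'
         × (∀ v → ¬ InF (torsoGraph G (V G ─ Z)) T T' v)
         × (∀ v → ¬ InR (torsoGraph G (V G ─ Z)) T T' v))
lemma13 G S T k Z (S⊆E , T⊆V , _ , T-acyclic) _ Z∩T=∅ = no-instance , shadowless
  where
    open Compression G S Z

    no-instance : ¬ HasSolution G S T k → ¬ HasSolution G' S' T k
    no-instance no-solution (T' , T'⊆C , size , T'∩T=∅ , torso-acyclic) =
      no-solution (T' , p─q⊆p (V G) Z ∘ T'⊆C , size , T'∩T=∅ ,
                   torso-acyclic ∘ Projection.project-closed T' T Z∩T=∅ T-acyclic)

    T⊆C : T ⊆ C
    T⊆C t∈T = x∈p∧x∉q⇒x∈p─q (T⊆V t∈T) (λ t∈Z → Z∩T=∅ _ t∈Z t∈T)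

    -- (2) expand S'-closed walks; a torso shadow would be a shadow in G,
    -- hence in Z, but torso vertices are kept.
    shadowless : ∀ T' → IsSolution G S T k T' →
      (∀ v → InF G T T' v ⊎ InR G T T' v → v ∈ Z) → Disjoint T' Z →
      IsSolution G' S' T k T' × (∀ v → ¬ InF G' T T' v) × (∀ v → ¬ InR G' T T' v)
    shadowless T' (T'⊆V , size , T'∩T=∅ , acyclic) shadows⊆Z T'∩Z=∅ =
      (T'⊆C , size , T'∩T=∅ , acyclic ∘ Expansion.expand-closed S⊆E T' T'∩Z=∅) ,
      (λ v f → x∈p─q⇒x∉q (V G) Z (proj₁ f) (shadows⊆Z v (inj₁ (torso-f⇒f f)))) ,
      (λ v r → x∈p─q⇒x∉q (V G) Z (proj₁ r) (shadows⊆Z v (inj₂ (torso-r⇒r r))))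
      where
        open Shadows T T' T⊆C T'⊆V
        T'⊆C : T' ⊆ C
        T'⊆C v∈T' = x∈p∧x∉q⇒x∈p─q (T'⊆V v∈T') (T'∩Z=∅ _ v∈T')
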